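{- Let $n\ge1$ and let $v$ be a non-Archimedean valuation on a field $\mathbb F$. Then every $c_v$-rainbow set of points of $\mathrm{PG}(n-1,\mathbb F)$ is independent (i.e. any choice of representing vectors is linearly independent in $\mathbb F^n$).
   Context: A non-Archimedean valuation on $\mathbb F$ is a function $v:\mathbb F\to\mathbb R\cup\{\infty\}$ with $v^{ -1}(\infty)=\{0\}$, $v(ab)=v(a)+v(b)$ and $v(a+b)\ge\min(v(a),v(b))$ for all $a,b$. $\mathrm{PG}(n-1,\mathbb F)$ has as points the one-dimensional subspaces $[u]$ of $\mathbb F^n$ ($u\ne0$). The colouring $c_v$ assigns to $[u]$, $u=(u_1,\dots,u_n)$, the smallest index $s$ with $v(u_s)=\min_iv(u_i)$ (this is independent of the representative $u$). A set of points is $c_v$-rainbow if $c_v$ is injective on it. -}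

module Defs where

open import Level using (Level; _⊔_; suc)
open import Algebra.Bundles using (CommutativeRing; AbelianGroup)
open import Relation.Binary.Structures using (IsTotalOrder)
open import Relation.Nullary using (¬_)
open import Data.Product using (Σ; _×_)
open import Data.Sum using (_⊎_)
open import Data.Nat using (ℕ)
open import Data.Fin using (Fin; _<_)
import Algebra.Definitions.RawMonoid as RawMonoidDefs

record Field (c ℓ : Level) : Set (suc (c ⊔ ℓ)) where
  field
    commutativeRing : CommutativeRing c ℓ
  open CommutativeRing commutativeRing public
  field
    0≉1 : ¬ (0# ≈ 1#)
    inverse : ∀ x → ¬ (x ≈ 0#) → Σ Carrier (λ y → (x * y) ≈ 1#)

  sum : ∀ {k} → (Fin k → Carrier) → Carrier
  sum = RawMonoidDefs.sum +-rawMonoid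

record OrderedAbelianGroup (a ℓ₁ ℓ₂ : Level) : Set (suc (a ⊔ ℓ₁ ⊔ ℓ₂)) where
  field
    abelianGroup : AbelianGroup a ℓ₁
  open AbelianGroup abelianGroup public
  field
    _≤_ : Carrier → Carrier → Set ℓ₂
    isTotalOrder : IsTotalOrder _≈_ _≤_
    ∙-monoˡ-≤ : ∀ {x y} z → x ≤ y → (x ∙ z) ≤ (y ∙ z)

data Ext {a} (A : Set a) : Set a where
  fin : A → Ext A
  ∞   : Ext A

module ExtOps {a ℓ₁ ℓ₂} (Γ : OrderedAbelianGroup a ℓ₁ ℓ₂) where
  open OrderedAbelianGroup Γ

  infix 4 _≈∞_ _≤∞_
  infixl 6 _+∞_
  data _≈∞_ : Ext Carrier → Ext Carrier → Set (a ⊔ ℓ₁) where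
    fin≈ : ∀ {x y} → x ≈ y → fin x ≈∞ fin y
    ∞≈   : ∞ ≈∞ ∞

  data _≤∞_ : Ext Carrier → Ext Carrier → Set (a ⊔ ℓ₂) where
    fin≤ : ∀ {x y} → x ≤ y → fin x ≤∞ fin y
    ≤-∞  : ∀ {x} → x ≤∞ ∞

  _+∞_ : Ext Carrier → Ext Carrier → Ext Carrier
  fin x +∞ fin y = fin (x ∙ y)
  fin x +∞ ∞ = ∞
  ∞ +∞ y = ∞

record Valuation {c ℓ a ℓ₁ ℓ₂} (F : Field c ℓ) (Γ : OrderedAbelianGroup a ℓ₁ ℓ₂)
       : Set (c ⊔ ℓ ⊔ a ⊔ ℓ₁ ⊔ ℓ₂) where
  open Field F
  open ExtOps Γ
  field
    v      : Carrier → Ext (OrderedAbelianGroup.Carrier Γ)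
    v-cong : ∀ {x y} → x ≈ y → v x ≈∞ v y
    v-∞⇒0  : ∀ x → v x ≈∞ ∞ → x ≈ 0#
    v-0    : v 0# ≈∞ ∞
    v-mult : ∀ x y → v (x * y) ≈∞ (v x +∞ v y)
    -- v(a+b) ≥ min(v a, v b)  (unfolded for a total order)
    v-ultra : ∀ x y → (v x ≤∞ v (x + y)) ⊎ (v y ≤∞ v (x + y))

module _ {c ℓ a ℓ₁ ℓ₂} {F : Field c ℓ} {Γ : OrderedAbelianGroup a ℓ₁ ℓ₂}
         (val : Valuation F Γ) where
  open Field F
  open ExtOps Γ
  open Valuation val

  -- u ∈ F^n is nonzero (so [u] is a point of PG(n-1,F))
  NonZeroVec : ∀ {n} → (Fin n → Carrier) → Set ℓ
  NonZeroVec u = ¬ (∀ i → u i ≈ 0#)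

  -- c_v([u]) = s : s is the smallest index with v(u_s) = min_i v(u_i)
  IsColour : ∀ {n} → (Fin n → Carrier) → Fin n → Set (a ⊔ ℓ₁ ⊔ ℓ₂)
  IsColour u s = (∀ i → v (u s) ≤∞ v (u i))
               × (∀ i → i < s → ¬ (v (u i) ≈∞ v (u s)))

module _ {c ℓ} (F : Field c ℓ) where
  open Field F
  LinIndep : ∀ {n k} → (Fin k → Fin n → Carrier) → Set (c ⊔ ℓ)
  LinIndep {n} {k} u =
    ∀ (α : Fin k → Carrier) → (∀ i → sum (λ j → α j * u j i) ≈ 0#) → ∀ j → α j ≈ 0#

{-# OPTIONS --safe #-}

-- Suppose Σⱼ αⱼ uⱼ = 0 and give each j the weight wⱼ = v(αⱼ uⱼ,cⱼ) = minᵢ v(αⱼ uⱼ,ᵢ),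
-- where cⱼ is the colour of uⱼ. If some weight were finite, pick j₀ of minimal weight
-- and, among those, of least colour s = c_{j₀}. In coordinate s every term αⱼ uⱼ,ₛ with
-- j ≠ j₀ has valuation strictly above w_{j₀}: equality would give wⱼ = w_{j₀} and make s
-- a position where uⱼ attains its minimum, so cⱼ ≤ s, hence cⱼ < s as the colouring is
-- injective. By the strict ultrametric inequality the s-th coordinate of Σⱼ αⱼ uⱼ then
-- has the finite valuation w_{j₀}, so it is nonzero. Thus all weights are ∞, i.e. all αⱼ = 0.
module Submission where

open import Defs
open import Level using (_⊔_)
open import Data.Nat using (ℕ; _≤_)
open import Data.Fin using (Fin)
open import Function.Definitions using (Injective)
open import Relation.Binary.PropositionalEquality using (_≡_)

import Data.Nat.Properties as ℕ
open import Data.Fin as Fin using (zero; suc)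
open import Data.Fin.Properties using (suc-injective; ≤∧≢⇒<)
open import Data.Fin.Induction using (<-wellFounded)
open import Data.List using (allFin)
open import Data.List.Relation.Unary.All using (lookup)
open import Data.List.Membership.Propositional.Properties using (∈-allFin)
import Data.List.Extrema as Extrema
open import Data.Product using (_,_; proj₁)
open import Data.Sum using (_⊎_; inj₁; inj₂)
open import Data.Empty using (⊥; ⊥-elim)
open import Function using (_∘_)
open import Induction.WellFounded using (Acc; acc)
open import Relation.Nullary using (¬_)
open import Relation.Binary.Bundles using (Poset; TotalOrder)
open import Relation.Binary.Structures using (IsEquivalence; IsTotalOrder)
import Relation.Binary.Properties.Poset as PosetProperties
import Relation.Binary.Reasoning.PartialOrder as PartialOrderReasoning
import Algebra.Properties.Group as GroupProperties
import Algebra.Properties.Ring as RingProperties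

module OrderedAbelianGroupProperties {a ℓ₁ ℓ₂} (Γ : OrderedAbelianGroup a ℓ₁ ℓ₂) where
  open OrderedAbelianGroup Γ
  open IsTotalOrder isTotalOrder
    using (total; antisym) renaming (trans to ≤-trans; reflexive to ≤-reflexive)

  x∙x≈ε⇒x≈ε : ∀ x → x ∙ x ≈ ε → x ≈ ε
  x∙x≈ε⇒x≈ε x x∙x≈ε with total x ε
  ... | inj₁ x≤ε = antisym x≤ε
    (≤-trans (≤-reflexive (sym x∙x≈ε)) (≤-trans (∙-monoˡ-≤ x x≤ε) (≤-reflexive (identityˡ x))))
  ... | inj₂ ε≤x = antisym
    (≤-trans (≤-reflexive (sym (identityˡ x))) (≤-trans (∙-monoˡ-≤ x ε≤x) (≤-reflexive x∙x≈ε))) ε≤x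

module ExtendedOrder {a ℓ₁ ℓ₂} (Γ : OrderedAbelianGroup a ℓ₁ ℓ₂) where
  open OrderedAbelianGroup Γ
  open ExtOps Γ public
  open OrderedAbelianGroupProperties Γ
  private module ≤ = IsTotalOrder isTotalOrder
  open GroupProperties group using (∙-cancelˡ; identityʳ-unique)

  Γ∞ : Set a
  Γ∞ = Ext Carrier

  ≈∞-refl : ∀ {x} → x ≈∞ x
  ≈∞-refl {fin x} = fin≈ refl
  ≈∞-refl {∞}     = ∞≈

  ≈∞-sym : ∀ {x y} → x ≈∞ y → y ≈∞ x
  ≈∞-sym (fin≈ x≈y) = fin≈ (sym x≈y)
  ≈∞-sym ∞≈         = ∞≈

  ≈∞-trans : ∀ {x y z} → x ≈∞ y → y ≈∞ z → x ≈∞ z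
  ≈∞-trans (fin≈ x≈y) (fin≈ y≈z) = fin≈ (trans x≈y y≈z)
  ≈∞-trans ∞≈         ∞≈         = ∞≈

  ≈∞-isEquivalence : IsEquivalence _≈∞_
  ≈∞-isEquivalence = record { refl = ≈∞-refl ; sym = ≈∞-sym ; trans = ≈∞-trans }

  ≤∞-reflexive : ∀ {x y} → x ≈∞ y → x ≤∞ y
  ≤∞-reflexive (fin≈ x≈y) = fin≤ (≤.reflexive x≈y)
  ≤∞-reflexive ∞≈         = ≤-∞

  ≤∞-trans : ∀ {x y z} → x ≤∞ y → y ≤∞ z → x ≤∞ z
  ≤∞-trans _          ≤-∞        = ≤-∞
  ≤∞-trans (fin≤ x≤y) (fin≤ y≤z) = fin≤ (≤.trans x≤y y≤z)

  ≤∞-antisym : ∀ {x y} → x ≤∞ y → y ≤∞ x → x ≈∞ y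
  ≤∞-antisym (fin≤ x≤y) (fin≤ y≤x) = fin≈ (≤.antisym x≤y y≤x)
  ≤∞-antisym ≤-∞        ≤-∞        = ∞≈

  ≤∞-total : ∀ x y → x ≤∞ y ⊎ y ≤∞ x
  ≤∞-total (fin x) (fin y) with ≤.total x y
  ... | inj₁ x≤y = inj₁ (fin≤ x≤y)
  ... | inj₂ y≤x = inj₂ (fin≤ y≤x)
  ≤∞-total (fin x) ∞ = inj₁ ≤-∞
  ≤∞-total ∞       y = inj₂ ≤-∞

  ≤∞-isTotalOrder : IsTotalOrder _≈∞_ _≤∞_
  ≤∞-isTotalOrder = record
    { isPartialOrder = record
      { isPreorder = record
        { isEquivalence = ≈∞-isEquivalence ; reflexive = ≤∞-reflexive ; trans = ≤∞-trans }
      ; antisym = ≤∞-antisym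
      }
    ; total = ≤∞-total
    }

  ≤∞-totalOrder : TotalOrder a (a ⊔ ℓ₁) (a ⊔ ℓ₂)
  ≤∞-totalOrder = record { isTotalOrder = ≤∞-isTotalOrder }

  ≤∞-poset : Poset a (a ⊔ ℓ₁) (a ⊔ ℓ₂)
  ≤∞-poset = TotalOrder.poset ≤∞-totalOrder

  open PosetProperties ≤∞-poset public using (≤∧≉⇒<; <⇒≱) renaming (_<_ to infix 4 _<∞_)

  infix 4 _≉∞_
  _≉∞_ : Γ∞ → Γ∞ → Set (a ⊔ ℓ₁)
  x ≉∞ y = ¬ x ≈∞ y

  ∞≤⇒≈∞ : ∀ {x} → ∞ ≤∞ x → x ≈∞ ∞
  ∞≤⇒≈∞ ≤-∞ = ∞≈

  ≈∞-stable : ∀ {x} → ¬ x ≉∞ ∞ → x ≈∞ ∞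
  ≈∞-stable {fin x} ¬x≉∞ = ⊥-elim (¬x≉∞ λ ())
  ≈∞-stable {∞}     _    = ∞≈

  +∞-cong : ∀ {x x′ y y′} → x ≈∞ x′ → y ≈∞ y′ → x +∞ y ≈∞ x′ +∞ y′
  +∞-cong (fin≈ x≈x′) (fin≈ y≈y′) = fin≈ (∙-cong x≈x′ y≈y′)
  +∞-cong (fin≈ _)    ∞≈          = ∞≈
  +∞-cong ∞≈          _           = ∞≈

  +∞-identityˡ : ∀ x → fin ε +∞ x ≈∞ x
  +∞-identityˡ (fin x) = fin≈ (identityˡ x)
  +∞-identityˡ ∞       = ∞≈

  +∞-monoʳ-≤ : ∀ z {x y} → x ≤∞ y → z +∞ x ≤∞ z +∞ y
  +∞-monoʳ-≤ (fin z) (fin≤ {x} {y} x≤y) =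
    fin≤ (≤.trans (≤.reflexive (comm z x)) (≤.trans (∙-monoˡ-≤ z x≤y) (≤.reflexive (comm y z))))
  +∞-monoʳ-≤ (fin z) ≤-∞ = ≤-∞
  +∞-monoʳ-≤ ∞       _   = ≤-∞

  +∞-cancelˡ : ∀ {x y z} → x ≉∞ ∞ → x +∞ y ≈∞ x +∞ z → y ≈∞ z
  +∞-cancelˡ {fin x} {fin y} {fin z} _   (fin≈ p) = fin≈ (∙-cancelˡ x y z p)
  +∞-cancelˡ {fin x} {∞}     {∞}     _   _        = ∞≈
  +∞-cancelˡ {∞}             x≉∞ _     = ⊥-elim (x≉∞ ∞≈)

  +∞-finiteˡ : ∀ {x y} → x +∞ y ≉∞ ∞ → x ≉∞ ∞
  +∞-finiteˡ x+y≉∞ ∞≈ = x+y≉∞ ∞≈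

  +∞-infiniteˡ : ∀ {x y} → y ≉∞ ∞ → x +∞ y ≈∞ ∞ → x ≈∞ ∞
  +∞-infiniteˡ {fin x} {fin y} _   ()
  +∞-infiniteˡ {fin x} {∞}     y≉∞ _ = ⊥-elim (y≉∞ ∞≈)
  +∞-infiniteˡ {∞}             _   _ = ∞≈

  x+∞x≈ε⇒x≈ε : ∀ {x} → x +∞ x ≈∞ fin ε → x ≈∞ fin ε
  x+∞x≈ε⇒x≈ε {fin x} (fin≈ x∙x≈ε) = fin≈ (x∙x≈ε⇒x≈ε x x∙x≈ε)
  x+∞x≈ε⇒x≈ε {∞}     ()

  x≈x+∞x⇒x≈ε : ∀ {x} → x ≉∞ ∞ → x ≈∞ x +∞ x → x ≈∞ fin ε
  x≈x+∞x⇒x≈ε {fin x} _   (fin≈ x≈x∙x) = fin≈ (identityʳ-unique x x (sym x≈x∙x))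
  x≈x+∞x⇒x≈ε {∞}     x≉∞ _           = ⊥-elim (x≉∞ ∞≈)

module ValuationProperties {c ℓ a ℓ₁ ℓ₂} {F : Field c ℓ} {Γ : OrderedAbelianGroup a ℓ₁ ℓ₂}
                           (val : Valuation F Γ) where
  open Field F hiding (zero)
  open Valuation val
  open OrderedAbelianGroup Γ using (ε)
  open ExtendedOrder Γ
  open PartialOrderReasoning ≤∞-poset
  open RingProperties ring using (-1*x≈-x)
  open GroupProperties +-group using (⁻¹-involutive)

  v-finite : ∀ {x} → ¬ x ≈ 0# → v x ≉∞ ∞
  v-finite x≉0 v[x]≈∞ = x≉0 (v-∞⇒0 _ v[x]≈∞)

  v-1# : v 1# ≈∞ fin ε
  v-1# = x≈x+∞x⇒x≈ε (v-finite (0≉1 ∘ sym))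
    (≈∞-trans (v-cong (sym (*-identityˡ 1#))) (v-mult 1# 1#))

  v-[-1#] : v (- 1#) ≈∞ fin ε
  v-[-1#] = x+∞x≈ε⇒x≈ε (begin-equality
    v (- 1#) +∞ v (- 1#)  ≈⟨ ≈∞-sym (v-mult (- 1#) (- 1#)) ⟩
    v (- 1# * - 1#)       ≈⟨ v-cong (trans (-1*x≈-x (- 1#)) (⁻¹-involutive 1#)) ⟩
    v 1#                  ≈⟨ v-1# ⟩
    fin ε                 ∎)

  v-neg : ∀ x → v (- x) ≈∞ v x
  v-neg x = begin-equality
    v (- x)              ≈⟨ v-cong (sym (-1*x≈-x x)) ⟩
    v (- 1# * x)         ≈⟨ v-mult (- 1#) x ⟩
    v (- 1#) +∞ v x      ≈⟨ +∞-cong v-[-1#] ≈∞-refl ⟩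
    fin ε +∞ v x         ≈⟨ +∞-identityˡ (v x) ⟩
    v x                  ∎

  <-v-+ : ∀ {m x y} → m <∞ v x → m <∞ v y → m <∞ v (x + y)
  <-v-+ {m} {x} {y} m<v[x] m<v[y] with v-ultra x y
  ... | inj₁ v[x]≤ = begin-strict m <⟨ m<v[x] ⟩ v x ≤⟨ v[x]≤ ⟩ v (x + y) ∎
  ... | inj₂ v[y]≤ = begin-strict m <⟨ m<v[y] ⟩ v y ≤⟨ v[y]≤ ⟩ v (x + y) ∎

  v-+-dominant : ∀ {x y} → v x <∞ v y → v (x + y) ≈∞ v x
  v-+-dominant {x} {y} v[x]<v[y] = ≤∞-antisym upper lower
    where
    x+y-y≈x : (x + y) + - y ≈ x
    x+y-y≈x = trans (+-assoc x y (- y)) (trans (+-congˡ (-‿inverseʳ y)) (+-identityʳ x))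

    lower : v x ≤∞ v (x + y)
    lower with v-ultra x y
    ... | inj₁ v[x]≤ = v[x]≤
    ... | inj₂ v[y]≤ = begin v x <⟨ v[x]<v[y] ⟩ v y ≤⟨ v[y]≤ ⟩ v (x + y) ∎

    upper : v (x + y) ≤∞ v x
    upper with v-ultra (x + y) (- y)
    ... | inj₁ v[x+y]≤ = ≤∞-trans v[x+y]≤ (≤∞-reflexive (v-cong x+y-y≈x))
    ... | inj₂ v[-y]≤ = ⊥-elim (<⇒≱ v[x]<v[y] (begin
      v y               ≈⟨ ≈∞-sym (v-neg y) ⟩
      v (- y)           ≤⟨ v[-y]≤ ⟩
      v ((x + y) + - y) ≈⟨ v-cong x+y-y≈x ⟩
      v x               ∎))

  <-v-sum : ∀ {k m} (f : Fin k → Carrier) → m ≉∞ ∞ → (∀ j → m <∞ v (f j)) → m <∞ v (sum f)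
  <-v-sum {ℕ.zero} {m} f m≉∞ _ = begin-strict m <⟨ ≤∧≉⇒< ≤-∞ m≉∞ ⟩ ∞ ≈⟨ ≈∞-sym v-0 ⟩ v 0# ∎
  <-v-sum {ℕ.suc k} f m≉∞ m<v[f] = <-v-+ (m<v[f] zero) (<-v-sum (f ∘ suc) m≉∞ (m<v[f] ∘ suc))

  v-sum-dominant : ∀ {k} (f : Fin k → Carrier) j₀ → v (f j₀) ≉∞ ∞ →
                   (∀ j → ¬ j ≡ j₀ → v (f j₀) <∞ v (f j)) → v (sum f) ≈∞ v (f j₀)
  v-sum-dominant f zero v[f₀]≉∞ dominant =
    v-+-dominant (<-v-sum (f ∘ suc) v[f₀]≉∞ (λ j → dominant (suc j) λ ()))
  v-sum-dominant f (suc j₀) v[fⱼ₀]≉∞ dominant = begin-equality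
    v (f zero + sum (f ∘ suc))  ≈⟨ v-cong (+-comm _ _) ⟩
    v (sum (f ∘ suc) + f zero)  ≈⟨ v-+-dominant tail<head ⟩
    v (sum (f ∘ suc))           ≈⟨ tail-dominant ⟩
    v (f (suc j₀))              ∎
    where
    tail-dominant : v (sum (f ∘ suc)) ≈∞ v (f (suc j₀))
    tail-dominant = v-sum-dominant (f ∘ suc) j₀ v[fⱼ₀]≉∞
      (λ j j≢j₀ → dominant (suc j) (j≢j₀ ∘ suc-injective))

    tail<head : v (sum (f ∘ suc)) <∞ v (f zero)
    tail<head = begin-strict
      v (sum (f ∘ suc))  ≈⟨ tail-dominant ⟩
      v (f (suc j₀))     <⟨ dominant zero (λ ()) ⟩
      v (f zero)         ∎

module Colouring {c ℓ a ℓ₁ ℓ₂} {F : Field c ℓ} {Γ : OrderedAbelianGroup a ℓ₁ ℓ₂}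
                 (val : Valuation F Γ) where
  open Field F hiding (zero)
  open Valuation val
  open ExtendedOrder Γ
  open PartialOrderReasoning ≤∞-poset
  open ValuationProperties val

  colour-finite : ∀ {n} {u : Fin n → Carrier} {s} →
                  NonZeroVec val u → IsColour val u s → v (u s) ≉∞ ∞
  colour-finite {u = u} u≢0 (s-minimal , _) v[uₛ]≈∞ =
    u≢0 λ i → v-∞⇒0 (u i) (∞≤⇒≈∞ (≤∞-trans (≤∞-reflexive (≈∞-sym v[uₛ]≈∞)) (s-minimal i)))

  colour-≤ : ∀ {n} {u : Fin n → Carrier} {s i} →
             IsColour val u s → v (u i) ≈∞ v (u s) → s Fin.≤ i
  colour-≤ {i = i} (_ , s-first) v[uᵢ]≈v[uₛ] = ℕ.≮⇒≥ (λ i<s → s-first i i<s v[uᵢ]≈v[uₛ])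

  module LinearRelation {n k} (u : Fin k → Fin n → Carrier)
    (col : Fin k → Fin n) (isColour : ∀ j → IsColour val (u j) (col j))
    (col-injective : Injective _≡_ _≡_ col)
    (α : Fin k → Carrier) (relation : ∀ i → sum (λ j → α j * u j i) ≈ 0#)
    where

    term : Fin n → Fin k → Carrier
    term i j = α j * u j i

    weight : Fin k → Γ∞
    weight j = v (term (col j) j)

    IsMinimal : Fin k → Set _
    IsMinimal j₀ = ∀ j → weight j₀ ≤∞ weight j

    weight-≤ : ∀ j i → weight j ≤∞ v (term i j)
    weight-≤ j i = begin
      v (α j * u j (col j))       ≈⟨ v-mult (α j) (u j (col j)) ⟩
      v (α j) +∞ v (u j (col j))  ≤⟨ +∞-monoʳ-≤ (v (α j)) (proj₁ (isColour j) i) ⟩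
      v (α j) +∞ v (u j i)        ≈⟨ ≈∞-sym (v-mult (α j) (u j i)) ⟩
      v (α j * u j i)             ∎

    weight-attained⇒colour-≤ : ∀ j i → weight j ≉∞ ∞ → v (term i j) ≈∞ weight j → col j Fin.≤ i
    weight-attained⇒colour-≤ j i w≉∞ v[term]≈w = colour-≤ (isColour j)
      (+∞-cancelˡ (+∞-finiteˡ (w≉∞ ∘ ≈∞-trans (v-mult (α j) (u j (col j))))) (begin-equality
        v (α j) +∞ v (u j i)        ≈⟨ ≈∞-sym (v-mult (α j) (u j i)) ⟩
        v (term i j)                ≈⟨ v[term]≈w ⟩
        v (α j * u j (col j))       ≈⟨ v-mult (α j) (u j (col j)) ⟩
        v (α j) +∞ v (u j (col j))  ∎))

    module _ {j₀} (j₀-minimal : IsMinimal j₀) (w₀≉∞ : weight j₀ ≉∞ ∞)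
             (least-colour : ∀ j → col j Fin.< col j₀ → weight j ≉∞ weight j₀) where

      term-dominant : ∀ j → ¬ j ≡ j₀ → weight j₀ <∞ v (term (col j₀) j)
      term-dominant j j≢j₀ = ≤∧≉⇒< (≤∞-trans (j₀-minimal j) (weight-≤ j (col j₀))) λ w₀≈v[term] →
        let wⱼ≈w₀ : weight j ≈∞ weight j₀
            wⱼ≈w₀ = ≤∞-antisym (≤∞-trans (weight-≤ j (col j₀)) (≤∞-reflexive (≈∞-sym w₀≈v[term])))
                               (j₀-minimal j)
            colⱼ≤col₀ = weight-attained⇒colour-≤ j (col j₀) (w₀≉∞ ∘ ≈∞-trans (≈∞-sym wⱼ≈w₀))
                          (≈∞-trans (≈∞-sym w₀≈v[term]) (≈∞-sym wⱼ≈w₀))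
        in least-colour j (≤∧≢⇒< colⱼ≤col₀ (j≢j₀ ∘ col-injective)) wⱼ≈w₀

      no-finite-minimum-of-least-colour : ⊥
      no-finite-minimum-of-least-colour = w₀≉∞ (begin-equality
        weight j₀              ≈⟨ ≈∞-sym (v-sum-dominant (term (col j₀)) j₀ w₀≉∞ term-dominant) ⟩
        v (sum (term (col j₀))) ≈⟨ v-cong (relation (col j₀)) ⟩
        v 0#                   ≈⟨ v-0 ⟩
        ∞                      ∎)

    -- Equality in Γ need not be decidable, so the minimiser of least colour cannot be
    -- chosen directly; instead we recurse on the colour of a minimiser.
    minimal-weight≈∞ : ∀ j₀ → Acc Fin._<_ (col j₀) → IsMinimal j₀ → weight j₀ ≈∞ ∞
    minimal-weight≈∞ j₀ (acc rec) j₀-minimal = ≈∞-stable λ w₀≉∞ →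
      no-finite-minimum-of-least-colour j₀-minimal w₀≉∞ λ j colⱼ<col₀ wⱼ≈w₀ →
        w₀≉∞ (≈∞-trans (≈∞-sym wⱼ≈w₀)
          (minimal-weight≈∞ j (rec colⱼ<col₀) (λ i → ≤∞-trans (≤∞-reflexive wⱼ≈w₀) (j₀-minimal i))))

    weight≈∞ : ∀ j → weight j ≈∞ ∞
    weight≈∞ j = ∞≤⇒≈∞ (begin
      ∞          ≈⟨ ≈∞-sym (minimal-weight≈∞ j₀ (<-wellFounded _) j₀-minimal) ⟩
      weight j₀  ≤⟨ j₀-minimal j ⟩
      weight j   ∎)
      where
      open Extrema ≤∞-totalOrder using (argmin; f[argmin]≤f[xs])
      j₀ = argmin weight j (allFin k)
      j₀-minimal : IsMinimal j₀
      j₀-minimal i = lookup (f[argmin]≤f[xs] j (allFin k)) (∈-allFin i)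

theorem12p1 : ∀ {c ℓ a ℓ₁ ℓ₂} (F : Field c ℓ) (Γ : OrderedAbelianGroup a ℓ₁ ℓ₂)
    (val : Valuation F Γ) (n : ℕ) → 1 ≤ n →
    ∀ (k : ℕ) (u : Fin k → Fin n → Field.Carrier F) →
    (∀ j → NonZeroVec val (u j)) →
    (col : Fin k → Fin n) → (∀ j → IsColour val (u j) (col j)) →
    Injective _≡_ _≡_ col →
    LinIndep F u
theorem12p1 F Γ val n _ k u u≢0 col isColour col-injective α relation j =
  v-∞⇒0 (α j) (+∞-infiniteˡ (colour-finite (u≢0 j) (isColour j))
    (≈∞-trans (≈∞-sym (v-mult (α j) (u j (col j)))) (weight≈∞ j)))
  where
  open Valuation val
  open ExtendedOrder Γ
  open Colouring val
  open Colouring.LinearRelation val u col isColour col-injective α relation
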